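{- For every weighted trigraph $(G,w)$ there exists a stable set $S$ of $G$ such that $S$ contains no zero-vertices of $(G,w)$ and $\mathrm{wt}_{(G,w)}(S)=\alpha(G,w)$.
   Context: A trigraph $G$ consists of a finite set $V(G)$ and a function $\theta_G:\binom{V(G)}{2}\to\{ -1,0,1\}$; for distinct vertices $u,v$ write $uv$ for $\{u,v\}$; it is semi-adjacent if $\theta_G(uv)=0$, and $u,v$ are anti-adjacent if $\theta_G(uv)\le 0$. A stable set is a set of pairwise anti-adjacent vertices. Let $D(G)=V(G)\cup\{(u,v): u,v\in V(G),u\neq v\}\cup\binom{V(G)}{2}$. A weight function for $G$ is a map $w:D(G)\to\mathbb{N}$ such that for all distinct $u,v$: if $uv$ is not semi-adjacent then $w(u,v)=w(v,u)=w(uv)=0$, and $w(u,v)\le w(uv)$. A weighted trigraph is a pair $(G,w)$. For $S\subseteq V(G)$, $\mathrm{wt}_{(G,w)}(S)=\sum_{u\in S}w(u)+\sum_{u\in S}\sum_{v\in V(G)\setminus S}w(u,v)+\sum_{uv\in\binom{V(G)\setminus S}{2}}w(uv)$, and $\alpha(G,w)=\max\{\mathrm{wt}_{(G,w)}(S): S\text{ a stable set of }G\}$. A zero-vertex of $(G,w)$ is a vertex $u$ with $w(u)=0$. -}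

module Defs where

open import Data.Nat using (ℕ; zero; suc; _+_; _≤_; _⊔_)
open import Data.Bool using (Bool; true; false; if_then_else_; _∧_)
open import Data.Fin using (Fin; toℕ)
open import Data.Fin.Subset using (Subset; _∈_; _∉_)
open import Data.Vec using (Vec; []; _∷_)
open import Data.List using (List; []; _∷_; map; allFin; foldr; filter; concatMap)
open import Data.Nat.ListAction using (sum)
open import Data.Product using (_×_)
open import Relation.Binary.PropositionalEquality using (_≡_; _≢_)
open import Relation.Nullary using (¬_)

data Adj : Set where
  minus1 : Adj
  zero0  : Adj
  plus1  : Adj

-- A trigraph with vertex set Fin n.  θ is given as a function of two
-- vertices, required to be symmetric on distinct pairs (so it is a
-- function on unordered pairs); its values on the diagonal are irrelevant.
record Trigraph : Set where
  field
    n     : ℕ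
    θ     : Fin n → Fin n → Adj
    θ-sym : ∀ u v → u ≢ v → θ u v ≡ θ v u

open Trigraph public

SemiAdjacent : (G : Trigraph) → Fin (n G) → Fin (n G) → Set
SemiAdjacent G u v = θ G u v ≡ zero0

AntiAdjacent : (G : Trigraph) → Fin (n G) → Fin (n G) → Set
AntiAdjacent G u v = θ G u v ≢ plus1

Stable : (G : Trigraph) → Subset (n G) → Set
Stable G S = ∀ u v → u ≢ v → u ∈ S → v ∈ S → AntiAdjacent G u v

-- A weight function on D(G): vertex weights wv, ordered-pair weights wo
-- (wo u v = w(u,v)), unordered-pair weights wp (wp u v = w(uv), required
-- symmetric on distinct pairs).  Diagonal values are never used.
record Weight (G : Trigraph) : Set where
  field
    wv     : Fin (n G) → ℕ
    wo     : Fin (n G) → Fin (n G) → ℕ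
    wp     : Fin (n G) → Fin (n G) → ℕ
    wp-sym : ∀ u v → u ≢ v → wp u v ≡ wp v u
    nonsemi-zero : ∀ u v → u ≢ v → ¬ SemiAdjacent G u v →
                   (wo u v ≡ 0) × (wo v u ≡ 0) × (wp u v ≡ 0)
    wo≤wp  : ∀ u v → u ≢ v → wo u v ≤ wp u v

open Weight public

mem : ∀ {m} → Fin m → Subset m → Bool
mem u S = Data.Vec.lookup S u
  where import Data.Vec

Σ[_] : ∀ {m} → (Fin m → ℕ) → ℕ
Σ[_] {m} f = sum (map f (allFin m))

ltb : ∀ {m} → Fin m → Fin m → Bool
ltb u v = Data.Nat._<ᵇ_ (toℕ u) (toℕ v)
  where import Data.Nat

wt : (G : Trigraph) → Weight G → Subset (n G) → ℕ
wt G w S =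
    Σ[ (λ u → if mem u S then wv w u else 0) ]
  + Σ[ (λ u → Σ[ (λ v → if mem u S ∧ Data.Bool.not (mem v S) then wo w u v else 0) ]) ]
  -- unordered pairs {u,v} ⊆ V∖S, each counted once via toℕ u < toℕ v
  + Σ[ (λ u → Σ[ (λ v → if Data.Bool.not (mem u S) ∧ Data.Bool.not (mem v S) ∧ ltb u v
                         then wp w u v else 0) ]) ]
  where import Data.Bool

allSubsets : (m : ℕ) → List (Subset m)
allSubsets zero    = [] ∷ []
allSubsets (suc m) = concatMap (λ S → (true ∷ S) ∷ (false ∷ S) ∷ []) (allSubsets m)

open import Relation.Nullary using (Dec; yes; no)
open import Data.Fin.Properties using () renaming (_≟_ to _≟F_)
open import Data.Fin.Subset.Properties using (_∈?_)
open import Data.List.Relation.Unary.All using (All)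

adj? : (a : Adj) → Dec (a ≢ plus1)
adj? minus1 = yes (λ ())
adj? zero0  = yes (λ ())
adj? plus1  = no (λ f → f _≡_.refl)

pairOK? : (G : Trigraph) (S : Subset (n G)) (u v : Fin (n G)) →
          Dec (u ≢ v → u ∈ S → v ∈ S → AntiAdjacent G u v)
pairOK? G S u v with u ≟F v | u ∈? S | v ∈? S | adj? (θ G u v)
... | yes e | _ | _ | _ = yes (λ ne → Data.Empty.⊥-elim (ne e))
  where import Data.Empty
... | no _ | no nu | _ | _ = yes (λ _ iu → Data.Empty.⊥-elim (nu iu))
  where import Data.Empty
... | no _ | yes _ | no nv | _ = yes (λ _ _ iv → Data.Empty.⊥-elim (nv iv))
  where import Data.Empty
... | no _ | yes _ | yes _ | yes a = yes (λ _ _ _ → a)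
... | no ne | yes iu | yes iv | no a = no (λ f → a (f ne iu iv))

stable? : (G : Trigraph) (S : Subset (n G)) → Dec (Stable G S)
stable? G S = Data.Fin.Properties.all? (λ u → Data.Fin.Properties.all? (λ v → pairOK? G S u v))
  where import Data.Fin.Properties

-- α(G,w): maximum of wt over all stable sets (the empty set is stable, and
-- weights are natural numbers, so starting the maximum at 0 is harmless).
α : (G : Trigraph) → Weight G → ℕ
α G w = foldr (λ S acc → wt G w S ⊔ acc) 0 (filter (stable? G) (allSubsets (n G)))

ZeroVertex : (G : Trigraph) → Weight G → Fin (n G) → Set
ZeroVertex G w u = wv w u ≡ 0

module Submission where

-- Removing a zero-vertex from a stable set S never decreases
-- its weight: the vertex term loses w(u) = 0, and the contribution of every
-- unordered pair {x,y} only grows when x or y leaves S, because it is 0 if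
-- both lie in S, w(x,y) if only x does, and w(xy) ≥ w(x,y) if neither does.
-- Hence, starting from a stable set of maximum weight and deleting all of its
-- zero-vertices gives a stable set (subsets of stable sets are stable) without
-- zero-vertices whose weight is still α(G,w).

open import Defs
open import Data.Fin.Subset using (_∈_)
open import Data.Product using (Σ; _×_)
open import Relation.Binary.PropositionalEquality using (_≡_)
open import Relation.Nullary using (¬_)

open import Data.Nat using (ℕ; zero; suc; _+_; _≤_; _⊔_; z≤n; _<ᵇ_; _≡ᵇ_)
open import Data.Nat.Properties
  using ( +-identityʳ; +-assoc; +-mono-≤; +-mono-<; ≤-refl; ≤-reflexive; ≤-trans
        ; ≤-antisym; ≤-total; ≤-<-connex; <⇒≱; <⇒≢; <⇒≯; ≮⇒≥; <ᵇ-reflects-<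
        ; m≤m⊔n; m≤n⊔m; ⊔-lub; +-0-commutativeMonoid; module ≤-Reasoning )
open import Data.Nat.ListAction using (sum)
open import Data.Bool using (Bool; true; false; if_then_else_; _∧_; not; b≤b; f≤t)
  renaming (_≤_ to _≤ᵇ_)
open import Data.Bool.Properties using (≤-minimum; ∧-conicalˡ; ∧-conicalʳ)
open import Data.Fin using (Fin; zero; suc; toℕ; _≟_)
open import Data.Fin.Properties using (toℕ-injective)
open import Data.Fin.Subset using (Subset; _∉_; _⊆_; ⊥)
open import Data.Fin.Subset.Properties using (∉⊥)
open import Data.Vec using ([]; _∷_; tabulate)
open import Data.Vec.Properties using ([]=⇒lookup; lookup⇒[]=; lookup∘tabulate)
open import Data.List using (List; []; _∷_; foldr; filter; concatMap)
import Data.List as List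
open import Data.List.Properties using (map-tabulate)
open import Data.List.Membership.Propositional using () renaming (_∈_ to _∈ˡ_)
open import Data.List.Relation.Unary.Any using (here; there)
open import Data.Product using (_,_)
open import Data.Sum using (inj₁; inj₂)
open import Function using (_∘_; id)
open import Relation.Nullary using (yes; no; contradiction)
open import Relation.Nullary.Reflects using (ofʸ; ofⁿ)
open import Relation.Unary using (Decidable)
open import Relation.Binary.PropositionalEquality
  using (refl; sym; trans; cong; cong₂; subst; subst₂; _≢_; module ≡-Reasoning)
import Algebra.Properties.CommutativeMonoid.Sum as CommutativeMonoidSum

open CommutativeMonoidSum +-0-commutativeMonoid
  using (∑-distrib-+; ∑-comm; sum-cong-≗) renaming (sum to ∑)

∑∑ : ∀ {m} → (Fin m → Fin m → ℕ) → ℕ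
∑∑ f = ∑ (λ x → ∑ (f x))

Σ≡∑ : ∀ {m} (f : Fin m → ℕ) → Σ[ f ] ≡ ∑ f
Σ≡∑ f = trans (cong sum (map-tabulate id f)) (sum-tabulate f)
  where
  sum-tabulate : ∀ {k} (g : Fin k → ℕ) → sum (List.tabulate g) ≡ ∑ g
  sum-tabulate {zero}  g = refl
  sum-tabulate {suc k} g = cong (g zero +_) (sum-tabulate (g ∘ suc))

Σ[Σ]≡∑∑ : ∀ {m} (f : Fin m → Fin m → ℕ) → Σ[ (λ x → Σ[ f x ]) ] ≡ ∑∑ f
Σ[Σ]≡∑∑ f = trans (Σ≡∑ (λ x → Σ[ f x ])) (sum-cong-≗ (λ x → Σ≡∑ (f x)))

∑-mono-≤ : ∀ {m} {f g : Fin m → ℕ} → (∀ i → f i ≤ g i) → ∑ f ≤ ∑ g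
∑-mono-≤ {zero}  f≤g = z≤n
∑-mono-≤ {suc m} f≤g = +-mono-≤ (f≤g zero) (∑-mono-≤ (f≤g ∘ suc))

∑∑-distrib-+ : ∀ {m} (f g : Fin m → Fin m → ℕ) →
               ∑∑ (λ x y → f x y + g x y) ≡ ∑∑ f + ∑∑ g
∑∑-distrib-+ f g =
  trans (sum-cong-≗ (λ x → ∑-distrib-+ (f x) (g x)))
        (∑-distrib-+ (λ x → ∑ (f x)) (λ x → ∑ (g x)))

∑∑-symmetrise : ∀ {m} (f : Fin m → Fin m → ℕ) →
                ∑∑ f + ∑∑ f ≡ ∑∑ (λ x y → f x y + f y x)
∑∑-symmetrise f = begin
  ∑∑ f + ∑∑ f                      ≡⟨ cong (∑∑ f +_) (∑-comm f) ⟩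
  ∑∑ f + ∑∑ (λ x y → f y x)        ≡⟨ sym (∑∑-distrib-+ f (λ x y → f y x)) ⟩
  ∑∑ (λ x y → f x y + f y x)       ∎
  where open ≡-Reasoning

double-cancel-≤ : ∀ a b → a + a ≤ b + b → a ≤ b
double-cancel-≤ a b a+a≤b+b with ≤-<-connex a b
... | inj₁ a≤b = a≤b
... | inj₂ b<a = contradiction a+a≤b+b (<⇒≱ (+-mono-< b<a b<a))

∑∑-mono-symmetrised : ∀ {m} (f g : Fin m → Fin m → ℕ) →
  (∀ x y → f x y + f y x ≤ g x y + g y x) → ∑∑ f ≤ ∑∑ g
∑∑-mono-symmetrised f g f≤g = double-cancel-≤ (∑∑ f) (∑∑ g) (begin
  ∑∑ f + ∑∑ f                   ≡⟨ ∑∑-symmetrise f ⟩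
  ∑∑ (λ x y → f x y + f y x)    ≤⟨ ∑-mono-≤ (λ x → ∑-mono-≤ (f≤g x)) ⟩
  ∑∑ (λ x y → g x y + g y x)    ≡⟨ sym (∑∑-symmetrise g) ⟩
  ∑∑ g + ∑∑ g                   ∎)
  where open ≤-Reasoning

-- Contribution of the ordered pair (x,y) to wt(S), where s = [x ∈ S],
-- t = [y ∈ S], o = w(x,y), p = w(xy) and lt = [x < y]; the flag lt makes
-- each unordered pair outside S count once.
orderedTerm : (s t : Bool) (o p : ℕ) (lt : Bool) → ℕ
orderedTerm s t o p lt =
  (if s ∧ not t then o else 0) + (if not s ∧ not t ∧ lt then p else 0)

pairTerm : (s t : Bool) (o₁ o₂ p : ℕ) → ℕ
pairTerm true  true  o₁ o₂ p = 0
pairTerm true  false o₁ o₂ p = o₁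
pairTerm false true  o₁ o₂ p = o₂
pairTerm false false o₁ o₂ p = p

-- The two comparison flags [x < y], [y < x] of distinct vertices.
data Opposite : Bool → Bool → Set where
  lt-gt : Opposite true false
  gt-lt : Opposite false true

orderedTerm-both : ∀ s t o₁ o₂ p {lt₁ lt₂} → Opposite lt₁ lt₂ →
  orderedTerm s t o₁ p lt₁ + orderedTerm t s o₂ p lt₂ ≡ pairTerm s t o₁ o₂ p
orderedTerm-both true  true  o₁ o₂ p _     = refl
orderedTerm-both true  false o₁ o₂ p _     = trans (+-identityʳ _) (+-identityʳ o₁)
orderedTerm-both false true  o₁ o₂ p _     = +-identityʳ o₂
orderedTerm-both false false o₁ o₂ p lt-gt = +-identityʳ p
orderedTerm-both false false o₁ o₂ p gt-lt = refl

orderedTerm-diagonal : ∀ s o p → orderedTerm s s o p false ≡ 0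
orderedTerm-diagonal true  o p = refl
orderedTerm-diagonal false o p = refl

pairTerm-antitone : ∀ {s t s' t'} {o₁ o₂ p} → o₁ ≤ p → o₂ ≤ p →
  s' ≤ᵇ s → t' ≤ᵇ t → pairTerm s t o₁ o₂ p ≤ pairTerm s' t' o₁ o₂ p
pairTerm-antitone             o₁≤p o₂≤p b≤b b≤b = ≤-refl
pairTerm-antitone {t = true}  o₁≤p o₂≤p f≤t b≤b = z≤n
pairTerm-antitone {t = false} o₁≤p o₂≤p f≤t b≤b = o₁≤p
pairTerm-antitone {s = true}  o₁≤p o₂≤p b≤b f≤t = z≤n
pairTerm-antitone {s = false} o₁≤p o₂≤p b≤b f≤t = o₂≤p
pairTerm-antitone             o₁≤p o₂≤p f≤t f≤t = z≤n

ltb-irrefl : ∀ {m} (x : Fin m) → ltb x x ≡ false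
ltb-irrefl x with toℕ x <ᵇ toℕ x | <ᵇ-reflects-< (toℕ x) (toℕ x)
... | true  | ofʸ x<x = contradiction refl (<⇒≢ x<x)
... | false | ofⁿ _   = refl

ltb-opposite : ∀ {m} {x y : Fin m} → x ≢ y → Opposite (ltb x y) (ltb y x)
ltb-opposite {x = x} {y} x≢y
  with toℕ x <ᵇ toℕ y | <ᵇ-reflects-< (toℕ x) (toℕ y)
     | toℕ y <ᵇ toℕ x | <ᵇ-reflects-< (toℕ y) (toℕ x)
... | true  | _        | false | _        = lt-gt
... | false | _        | true  | _        = gt-lt
... | true  | ofʸ x<y  | true  | ofʸ y<x  = contradiction y<x (<⇒≯ x<y)
... | false | ofⁿ x≮y  | false | ofⁿ y≮x  =
  contradiction (toℕ-injective (≤-antisym (≮⇒≥ y≮x) (≮⇒≥ x≮y))) x≢y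

mem-true⇒∈ : ∀ {m} {x : Fin m} {S : Subset m} → mem x S ≡ true → x ∈ S
mem-true⇒∈ {x = x} {S} = lookup⇒[]= x S

mem-false⇒∉ : ∀ {m} {x : Fin m} {S : Subset m} → mem x S ≡ false → x ∉ S
mem-false⇒∉ x∉S x∈S with () ← trans (sym ([]=⇒lookup x∈S)) x∉S

mem-mono : ∀ {m} {S T : Subset m} → T ⊆ S → ∀ x → mem x T ≤ᵇ mem x S
mem-mono {S = S} {T} T⊆S x with mem x T in x∈T
... | false = ≤-minimum (mem x S)
... | true rewrite []=⇒lookup (T⊆S (mem-true⇒∈ {S = T} x∈T)) = b≤b

module WeightDecomposition (G : Trigraph) (w : Weight G) where

  vertexTerm : Subset (n G) → Fin (n G) → ℕ
  vertexTerm S u = if mem u S then wv w u else 0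

  edgeTerm : Subset (n G) → Fin (n G) → Fin (n G) → ℕ
  edgeTerm S x y = orderedTerm (mem x S) (mem y S) (wo w x y) (wp w x y) (ltb x y)

  wt-split : ∀ S → wt G w S ≡ ∑ (vertexTerm S) + ∑∑ (edgeTerm S)
  wt-split S = begin
    Σ[ vertexTerm S ] + Σ[ (λ x → Σ[ out x ]) ] + Σ[ (λ x → Σ[ both x ]) ]
      ≡⟨ +-assoc Σ[ vertexTerm S ] _ _ ⟩
    Σ[ vertexTerm S ] + (Σ[ (λ x → Σ[ out x ]) ] + Σ[ (λ x → Σ[ both x ]) ])
      ≡⟨ cong₂ _+_ (Σ≡∑ (vertexTerm S)) (cong₂ _+_ (Σ[Σ]≡∑∑ out) (Σ[Σ]≡∑∑ both)) ⟩
    ∑ (vertexTerm S) + (∑∑ out + ∑∑ both)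
      ≡⟨ cong (∑ (vertexTerm S) +_) (sym (∑∑-distrib-+ out both)) ⟩
    ∑ (vertexTerm S) + ∑∑ (edgeTerm S) ∎
    where
    open ≡-Reasoning
    out both : Fin (n G) → Fin (n G) → ℕ
    out  x y = if mem x S ∧ not (mem y S) then wo w x y else 0
    both x y = if not (mem x S) ∧ not (mem y S) ∧ ltb x y then wp w x y else 0

  edgeTerm-both : ∀ S {x y} → x ≢ y →
    edgeTerm S x y + edgeTerm S y x ≡ pairTerm (mem x S) (mem y S) (wo w x y) (wo w y x) (wp w x y)
  edgeTerm-both S {x} {y} x≢y rewrite wp-sym w y x (x≢y ∘ sym) =
    orderedTerm-both (mem x S) (mem y S) (wo w x y) (wo w y x) (wp w x y) (ltb-opposite x≢y)

  -- The pair part of wt(S) can only grow when S shrinks: compare both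
  -- orientations of each pair, which vanish on the diagonal.
  edgeSum-antitone : ∀ {S T} → T ⊆ S → ∑∑ (edgeTerm S) ≤ ∑∑ (edgeTerm T)
  edgeSum-antitone {S} {T} T⊆S = ∑∑-mono-symmetrised (edgeTerm S) (edgeTerm T) pair
    where
    pair : ∀ x y → edgeTerm S x y + edgeTerm S y x ≤ edgeTerm T x y + edgeTerm T y x
    pair x y with x ≟ y
    ... | yes refl rewrite ltb-irrefl x
                         | orderedTerm-diagonal (mem x S) (wo w x x) (wp w x x) = z≤n
    ... | no x≢y = subst₂ _≤_ (sym (edgeTerm-both S x≢y)) (sym (edgeTerm-both T x≢y))
                     (pairTerm-antitone (wo≤wp w x y x≢y) wo[y,x]≤wp
                                        (mem-mono T⊆S x) (mem-mono T⊆S y))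
      where
      wo[y,x]≤wp : wo w y x ≤ wp w x y
      wo[y,x]≤wp = subst (wo w y x ≤_) (wp-sym w y x (x≢y ∘ sym)) (wo≤wp w y x (x≢y ∘ sym))

  vertexSum-removal : ∀ {S T} → T ⊆ S → (∀ u → u ∈ S → u ∉ T → ZeroVertex G w u) →
                      ∑ (vertexTerm S) ≤ ∑ (vertexTerm T)
  vertexSum-removal {S} {T} T⊆S removed-zero = ∑-mono-≤ vertex
    where
    vertex : ∀ u → vertexTerm S u ≤ vertexTerm T u
    vertex u with mem u S in u∈S | mem u T in u∈T
    ... | false | _     = z≤n
    ... | true  | true  = ≤-refl
    ... | true  | false = ≤-reflexive
      (removed-zero u (mem-true⇒∈ {S = S} u∈S) (mem-false⇒∉ {S = T} u∈T))

  wt-removal : ∀ {S T} → T ⊆ S → (∀ u → u ∈ S → u ∉ T → ZeroVertex G w u) →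
               wt G w S ≤ wt G w T
  wt-removal {S} {T} T⊆S removed-zero =
    subst₂ _≤_ (sym (wt-split S)) (sym (wt-split T))
      (+-mono-≤ (vertexSum-removal T⊆S removed-zero) (edgeSum-antitone T⊆S))

module DeleteZeros (G : Trigraph) (w : Weight G) where

  dropZeros : Subset (n G) → Subset (n G)
  dropZeros S = tabulate (λ u → mem u S ∧ not (wv w u ≡ᵇ 0))

  mem-dropZeros : ∀ S u → mem u (dropZeros S) ≡ mem u S ∧ not (wv w u ≡ᵇ 0)
  mem-dropZeros S u = lookup∘tabulate (λ u → mem u S ∧ not (wv w u ≡ᵇ 0)) u

  dropZeros-⊆ : ∀ S → dropZeros S ⊆ S
  dropZeros-⊆ S {u} u∈D = mem-true⇒∈ {S = S}
    (∧-conicalˡ _ _ (trans (sym (mem-dropZeros S u)) ([]=⇒lookup u∈D)))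

  dropZeros-nonZero : ∀ S u → u ∈ dropZeros S → ¬ ZeroVertex G w u
  dropZeros-nonZero S u u∈D wv≡0
    with () ← subst (λ k → not (k ≡ᵇ 0) ≡ true) wv≡0
                (∧-conicalʳ _ _ (trans (sym (mem-dropZeros S u)) ([]=⇒lookup u∈D)))

  dropZeros-removed : ∀ S u → u ∈ S → u ∉ dropZeros S → ZeroVertex G w u
  dropZeros-removed S u u∈S u∉D with wv w u in wv≡
  ... | zero  = refl
  ... | suc _ = contradiction (mem-true⇒∈ {S = dropZeros S} u∈D) u∉D
    where
    u∈D : mem u (dropZeros S) ≡ true
    u∈D = trans (mem-dropZeros S u)
                (cong₂ _∧_ ([]=⇒lookup u∈S) (cong (λ k → not (k ≡ᵇ 0)) wv≡))

stable-⊆ : (G : Trigraph) {S T : Subset (n G)} → T ⊆ S → Stable G S → Stable G T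
stable-⊆ G T⊆S stable u v u≢v u∈T v∈T = stable u v u≢v (T⊆S u∈T) (T⊆S v∈T)

module Maximum {X : Set} {P : X → Set} (P? : Decidable P) (f : X → ℕ) where

  maxOver : List X → ℕ
  maxOver xs = foldr (λ x acc → f x ⊔ acc) 0 (filter P? xs)

  maxOver-upper : ∀ {x} xs → x ∈ˡ xs → P x → f x ≤ maxOver xs
  maxOver-upper (y ∷ xs) (here refl) Px with P? y
  ... | yes _  = m≤m⊔n (f y) (maxOver xs)
  ... | no ¬Py = contradiction Px ¬Py
  maxOver-upper (y ∷ xs) (there x∈xs) Px with P? y
  ... | yes _ = ≤-trans (maxOver-upper xs x∈xs Px) (m≤n⊔m (f y) (maxOver xs))
  ... | no _  = maxOver-upper xs x∈xs Px

  maxOver-attained : ∀ {d} → P d → ∀ xs → Σ X λ x → P x × maxOver xs ≤ f x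
  maxOver-attained Pd [] = _ , Pd , z≤n
  maxOver-attained Pd (y ∷ xs) with P? y | maxOver-attained Pd xs
  ... | no _   | best = best
  ... | yes Py | (x , Px , max≤fx) with ≤-total (f y) (f x)
  ...   | inj₁ fy≤fx = x , Px , ⊔-lub fy≤fx max≤fx
  ...   | inj₂ fx≤fy = y , Py , ⊔-lub ≤-refl (≤-trans max≤fx fx≤fy)

allSubsets-complete : ∀ m (S : Subset m) → S ∈ˡ allSubsets m
allSubsets-complete zero    []      = here refl
allSubsets-complete (suc m) (b ∷ S) = extend b (allSubsets-complete m S)
  where
  extend : ∀ {k} b {S : Subset k} {Ss} → S ∈ˡ Ss →
           (b ∷ S) ∈ˡ concatMap (λ S → (true ∷ S) ∷ (false ∷ S) ∷ []) Ss
  extend true  (here refl) = here refl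
  extend false (here refl) = there (here refl)
  extend b     (there S∈Ss) = there (there (extend b S∈Ss))

empty-stable : (G : Trigraph) → Stable G ⊥
empty-stable G u v u≢v u∈⊥ v∈⊥ = contradiction u∈⊥ ∉⊥

-- Take a stable set S of maximum weight (α G w is definitionally the maximum
-- maxOver of wt over stable subsets) and delete its zero-vertices.
proposition3p2 : (G : Trigraph) (w : Weight G) →
    Σ _ λ S → Stable G S × (∀ u → u ∈ S → ¬ ZeroVertex G w u) × (wt G w S ≡ α G w)
proposition3p2 G w
  with Maximum.maxOver-attained (stable? G) (wt G w) (empty-stable G) (allSubsets (n G))
... | S , stable-S , α≤wtS =
  T , stable-T , dropZeros-nonZero S ,
  ≤-antisym (maxOver-upper (allSubsets (n G)) (allSubsets-complete (n G) T) stable-T)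
            (≤-trans α≤wtS (wt-removal (dropZeros-⊆ S) (dropZeros-removed S)))
  where
  open Maximum (stable? G) (wt G w)
  open WeightDecomposition G w
  open DeleteZeros G w
  T : Subset (n G)
  T = dropZeros S
  stable-T : Stable G T
  stable-T = stable-⊆ G (dropZeros-⊆ S) stable-S
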